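{- For every $k\ge1$, let $I_k$ be an interval order whose comparability graph is the complement $\bar G_k$ of $G_k$. Then $H(I_k)\le (k+1)/2$.
   Context: Logarithms are base 2. Graphs $G_k$: $G_1$ is a single vertex; for $k\ge2$, $G_k$ is obtained by taking the disjoint union of a clique $K_{2^{k-1}}$ (the central clique) with two copies of $G_{k-1}$, and making half of the vertices of the central clique adjacent to all vertices of the first copy and the other half adjacent to all vertices of the second copy. $G_k$ is an interval graph on $k2^{k-1}$ vertices; given an interval representation of $G_k$ by open intervals, $I_k$ is the interval order in which $v<w$ iff the interval of $v$ lies entirely to the left of that of $w$, so its comparability graph is $\bar G_k$. For a poset $Q$ on $n$ elements, $H(Q):=\min_{x\in\mathrm{STAB}(G(Q))}-\frac1n\sum_v\log x_v$, where $G(Q)$ is the comparability graph and $\mathrm{STAB}$ is the convex hull of the characteristic vectors of stable sets. -}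

module Defs where

open import Data.Nat using (ℕ; zero; suc; _^_)
import Data.Nat as ℕ
open import Data.Bool using (Bool; true; false)
open import Data.Fin using (Fin)
open import Data.List using (List; []; _∷_; map; _++_; length; foldr; allFin)
open import Data.Product using (Σ; _×_; _,_; ∃)
open import Data.Sum using (_⊎_; inj₁; inj₂)
open import Data.Unit using (⊤; tt)
open import Data.Empty using (⊥)
open import Relation.Nullary using (¬_)
open import Relation.Binary.PropositionalEquality using (_≡_; _≢_)
import Data.List.Membership.Propositional
import Data.Product
open import Data.Rational using (ℚ; 0ℚ; 1ℚ; ½; _+_; _*_; _≤_)

-- GV m is the vertex set of G_(m+1).
--   G_(m+2) : central clique K_(2^(m+1)), written Bool × Fin (2^m)
--             (the Bool selects the half), plus two copies of G_(m+1),
--             written Bool × GV m (the Bool selects the copy);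
--             the half b of the clique is complete to copy b.

GV : ℕ → Set
GV zero    = ⊤
GV (suc m) = (Bool × Fin (2 ^ m)) ⊎ (Bool × GV m)

Adj : (m : ℕ) → GV m → GV m → Set
Adj zero    _ _ = ⊥
Adj (suc m) (inj₁ c) (inj₁ d) = c ≢ d
Adj (suc m) (inj₁ (b , _)) (inj₂ (b' , _)) = b ≡ b'
Adj (suc m) (inj₂ (b , _)) (inj₁ (b' , _)) = b ≡ b'
Adj (suc m) (inj₂ (b , v)) (inj₂ (b' , w)) = (b ≡ b') × Adj m v w

allGV : (m : ℕ) → List (GV m)
allGV zero    = tt ∷ []
allGV (suc m) =
  map inj₁ (map (true ,_) (allFin (2 ^ m)) ++ map (false ,_) (allFin (2 ^ m)))
  ++ map inj₂ (map (true ,_) (allGV m) ++ map (false ,_) (allGV m))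

record IsStrictPoset {V : Set} (_<_ : V → V → Set) : Set where
  field
    irrefl : ∀ v → ¬ (v < v)
    trans  : ∀ {u v w} → u < v → v < w → u < w

-- interval order: strict partial order that is (2+2)-free
-- (Fishburn's characterisation of orders representable by intervals)
IsIntervalOrder : {V : Set} → (V → V → Set) → Set
IsIntervalOrder {V} _<_ =
  IsStrictPoset _<_ ×
  (∀ a b c d → a < b → c < d → (a < d) ⊎ (c < b))

Comparable : {V : Set} → (V → V → Set) → V → V → Set
Comparable _<_ v w = (v < w) ⊎ (w < v)

IsStable : {V : Set} → (V → V → Set) → (V → Bool) → Set
IsStable _<_ S = ∀ v w → S v ≡ true → S w ≡ true → ¬ Comparable _<_ v w

χ : Bool → ℚ
χ true  = 1ℚ
χ false = 0ℚ

record ConvexComb {V : Set} (_<_ : V → V → Set) : Set where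
  field
    terms   : List (ℚ × (V → Bool))
    nonneg  : ∀ {λ' S} → Data.List.Membership.Propositional._∈_ (λ' , S) terms → 0ℚ ≤ λ'
    stable  : ∀ {λ' S} → Data.List.Membership.Propositional._∈_ (λ' , S) terms → IsStable _<_ S
    sumOne  : foldr (λ t acc → Data.Product.proj₁ t + acc) 0ℚ terms ≡ 1ℚ

  point : V → ℚ
  point v = foldr (λ t acc → Data.Product.proj₁ t * χ (Data.Product.proj₂ t v) + acc) 0ℚ terms



powℚ : ℚ → ℕ → ℚ
powℚ q zero    = 1ℚ
powℚ q (suc n) = q * powℚ q n

prodℚ : {V : Set} → List V → (V → ℚ) → ℚ
prodℚ vs x = foldr (λ v acc → x v * acc) 1ℚ vs

-- HAtMost _<_ vs p q  expresses  H(Q) ≤ p / q  for the poset Q on the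
-- elements listed (without repetition) in vs, n = length vs:
--   ∃ x ∈ STAB(G(Q)) with  -(1/n) Σ_v log₂ x_v ≤ p/q,
-- equivalently (q ≥ 1)  (Π_v x_v)^q ≥ 2^(-n p).
HAtMost : {V : Set} → (V → V → Set) → List V → ℕ → ℕ → Set
HAtMost _<_ vs p q =
  Σ (ConvexComb _<_) λ c →
    powℚ ½ (length vs ℕ.* p) ≤ powℚ (prodℚ vs (ConvexComb.point c)) q

{-# OPTIONS --safe #-}
-- Only the comparability graph of I_k matters: it is the complement of G_k, so every
-- clique of G_k is a stable set, and STAB contains every convex combination of cliques.
-- A maximal clique of G_(k+1) is one half of the central clique together with a maximal
-- clique of the copy of G_k attached to that half; giving each of the two choices half
-- the weight yields a combination in which a vertex lying in a central clique at depth d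
-- receives x_v = 2^(-d). Hence -Σ log x_v is the total depth D_k, and the recursion
-- D_(k+1) = 2^k + 2 (|G_k| + D_k) gives 2 D_k + 2^k = k (k+1) 2^(k-1) ≤ |G_k| (k+1).
module Submission where

open import Data.Bool using (Bool; true; false; not; _∧_)
open import Data.List using (List; []; _∷_; map; _++_; length; foldr; allFin)
open import Data.List.Properties using (map-++; map-∘; length-tabulate)
open import Data.List.Relation.Unary.All as All using (All; []; _∷_)
open import Data.List.Relation.Unary.All.Properties using (map⁺; ++⁺)
open import Data.Nat using (ℕ; zero; suc)
import Data.Nat as ℕ
open import Data.Nat.ListAction using (sum)
open import Data.Product using (_×_; _,_; proj₁; proj₂)
open import Data.Sum using (inj₁; inj₂)
open import Function using (_∘_; id)
open import Function.Bundles using (_⇔_; module Equivalence)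
open import Relation.Nullary using (¬_)
open import Relation.Nullary.Decidable using (from-yes)
open import Relation.Binary.PropositionalEquality
  using (_≡_; _≢_; refl; sym; trans; cong; cong₂; module ≡-Reasoning)
import Data.Rational as ℚ
import Data.Rational.Properties as ℚP

open import Defs

private variable
  V W : Set
  m : ℕ

IsClique : (V → V → Set) → (V → Bool) → Set
IsClique E S = ∀ v w → S v ≡ true → S w ≡ true → v ≢ w → E v w

clique⇒stable : {_<_ E : V → V → Set} {S : V → Bool} →
                (∀ v w → Comparable _<_ v w → v ≢ w × ¬ E v w) →
                IsClique E S → IsStable _<_ S
clique⇒stable incomparable S-clique v w v∈S w∈S v~w =
  let v≢w , ¬vEw = incomparable v w v~w in ¬vEw (S-clique v w v∈S w∈S v≢w)

_==_ : Bool → Bool → Bool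
true  == b = b
false == b = not b

==-sound : ∀ b b' → b == b' ≡ true → b ≡ b'
==-sound true  true  _ = refl
==-sound false false _ = refl

∧-true⁻ : ∀ x {y} → x ∧ y ≡ true → x ≡ true × y ≡ true
∧-true⁻ true y≡true = refl , y≡true

side : GV (suc m) → Bool
side (inj₁ (b , _)) = b
side (inj₂ (b , _)) = b

extend : Bool → (GV m → Bool) → GV (suc m) → Bool
extend b S (inj₁ (b' , _)) = b == b'
extend b S (inj₂ (b' , v)) = (b == b') ∧ S v

extend-side : ∀ b {S : GV m → Bool} v → extend b S v ≡ true → b ≡ side v
extend-side b (inj₁ (b' , _)) v∈S = ==-sound b b' v∈S
extend-side b (inj₂ (b' , _)) v∈S = ==-sound b b' (proj₁ (∧-true⁻ (b == b') v∈S))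

extend-sameSide : ∀ b {S : GV m → Bool} v w →
                  extend b S v ≡ true → extend b S w ≡ true → side v ≡ side w
extend-sameSide b v w v∈S w∈S = trans (sym (extend-side b v v∈S)) (extend-side b w w∈S)

extend-clique : ∀ b {S : GV m → Bool} → IsClique (Adj m) S → IsClique (Adj (suc m)) (extend b S)
extend-clique b S-clique (inj₁ _) (inj₁ _) _ _ v≢w = v≢w ∘ cong inj₁
extend-clique b {S} _ v@(inj₁ _) w@(inj₂ _) v∈S w∈S _ = extend-sameSide b {S} v w v∈S w∈S
extend-clique b {S} _ v@(inj₂ _) w@(inj₁ _) v∈S w∈S _ = extend-sameSide b {S} v w v∈S w∈S
extend-clique b {S} S-clique v@(inj₂ (b₁ , v')) w@(inj₂ (b₂ , w')) v∈S w∈S v≢w =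
  b₁≡b₂ , S-clique v' w' (inner b₁ v∈S) (inner b₂ w∈S) (v≢w ∘ cong₂ (λ c u → inj₂ (c , u)) b₁≡b₂)
  where
  b₁≡b₂ : b₁ ≡ b₂
  b₁≡b₂ = extend-sameSide b {S} v w v∈S w∈S
  inner : ∀ c {u} → (b == c) ∧ S u ≡ true → S u ≡ true
  inner c u∈S = proj₂ (∧-true⁻ (b == c) u∈S)

depth : GV m → ℕ
depth {zero}  _              = 0
depth {suc m} (inj₁ _)       = 1
depth {suc m} (inj₂ (_ , v)) = suc (depth v)

module CliqueCover where
  open import Data.Rational using (ℚ; 0ℚ; 1ℚ; ½; _+_; _*_; _≤_; NonNegative)
  open import Data.Rational.Properties
    using (_≤?_; +-identityˡ; +-identityʳ; +-assoc; *-identityˡ; *-identityʳ; *-zeroʳ; *-assoc; *-distribˡ-+;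
           *-monoˡ-≤-nonNeg; nonNegative⁻¹; ≤-refl; ≤-trans; ≤-reflexive; module ≤-Reasoning)

  Family : Set → Set
  Family V = List (ℚ × (V → Bool))

  totalWeight : Family V → ℚ
  totalWeight = foldr (λ t acc → proj₁ t + acc) 0ℚ

  -- ConvexComb.point c v is definitionally weightWhere (ConvexComb.terms c) (λ S → S v).
  weightWhere : Family V → ((V → Bool) → Bool) → ℚ
  weightWhere ts P = foldr (λ t acc → proj₁ t * χ (P (proj₂ t)) + acc) 0ℚ ts

  rescale : ℚ → ((V → Bool) → (W → Bool)) → Family V → Family W
  rescale c f = map (λ t → c * proj₁ t , f (proj₂ t))

  weightWhere-++ : (xs ys : Family V) (P : (V → Bool) → Bool) →
                   weightWhere (xs ++ ys) P ≡ weightWhere xs P + weightWhere ys P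
  weightWhere-++ []       ys P = sym (+-identityˡ _)
  weightWhere-++ (t ∷ xs) ys P =
    trans (cong (a +_) (weightWhere-++ xs ys P)) (sym (+-assoc a (weightWhere xs P) _))
    where a = proj₁ t * χ (P (proj₂ t))

  weightWhere-true : (ts : Family V) → weightWhere ts (λ _ → true) ≡ totalWeight ts
  weightWhere-true []       = refl
  weightWhere-true (t ∷ ts) = cong₂ _+_ (*-identityʳ (proj₁ t)) (weightWhere-true ts)

  weightWhere-false : (ts : Family V) → weightWhere ts (λ _ → false) ≡ 0ℚ
  weightWhere-false []       = refl
  weightWhere-false (t ∷ ts) = cong₂ _+_ (*-zeroʳ (proj₁ t)) (weightWhere-false ts)

  weightWhere-rescale : ∀ c (f : (V → Bool) → (W → Bool)) ts P →
                        weightWhere (rescale c f ts) P ≡ c * weightWhere ts (P ∘ f)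
  weightWhere-rescale c f []               P = sym (*-zeroʳ c)
  weightWhere-rescale c f ((w , S) ∷ ts) P = begin
    c * w * χ (P (f S)) + weightWhere (rescale c f ts) P
      ≡⟨ cong₂ _+_ (*-assoc c w _) (weightWhere-rescale c f ts P) ⟩
    c * (w * χ (P (f S))) + c * weightWhere ts (P ∘ f)
      ≡⟨ sym (*-distribˡ-+ c _ _) ⟩
    c * (w * χ (P (f S)) + weightWhere ts (P ∘ f)) ∎
    where open ≡-Reasoning

  NonNegativeWeights : Family V → Set
  NonNegativeWeights = All (λ t → 0ℚ ≤ proj₁ t)

  rescale-nonNeg : ∀ c .{{_ : NonNegative c}} (f : (V → Bool) → (W → Bool)) {ts} →
                   NonNegativeWeights ts → NonNegativeWeights (rescale c f ts)
  rescale-nonNeg c f = map⁺ ∘ All.map scale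
    where
    scale : ∀ {w} → 0ℚ ≤ w → 0ℚ ≤ c * w
    scale {w} 0≤w = ≤-trans (≤-reflexive (sym (*-zeroʳ c))) (*-monoˡ-≤-nonNeg c 0≤w)

  powℚ-+ : ∀ q a b → powℚ q (a ℕ.+ b) ≡ powℚ q a * powℚ q b
  powℚ-+ q zero    b = sym (*-identityˡ _)
  powℚ-+ q (suc a) b = trans (cong (q *_) (powℚ-+ q a b)) (sym (*-assoc q _ _))

  powℚ-powℚ : ∀ q a n → powℚ (powℚ q a) n ≡ powℚ q (n ℕ.* a)
  powℚ-powℚ q a zero    = refl
  powℚ-powℚ q a (suc n) = trans (cong (powℚ q a *_) (powℚ-powℚ q a n)) (sym (powℚ-+ q a (n ℕ.* a)))

  prodℚ-powℚ : ∀ q (vs : List V) {x : V → ℚ} (e : V → ℕ) →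
               (∀ v → x v ≡ powℚ q (e v)) → prodℚ vs x ≡ powℚ q (sum (map e vs))
  prodℚ-powℚ q []       e x≡q^e = refl
  prodℚ-powℚ q (v ∷ vs) e x≡q^e =
    trans (cong₂ _*_ (x≡q^e v) (prodℚ-powℚ q vs e x≡q^e)) (sym (powℚ-+ q (e v) _))

  powℚ≤1 : ∀ {q} .{{_ : NonNegative q}} → q ≤ 1ℚ → ∀ n → powℚ q n ≤ 1ℚ
  powℚ≤1         q≤1 zero    = ≤-refl
  powℚ≤1 {q} q≤1 (suc n) = begin
    q * powℚ q n ≤⟨ *-monoˡ-≤-nonNeg q (powℚ≤1 q≤1 n) ⟩
    q * 1ℚ       ≡⟨ *-identityʳ q ⟩
    q            ≤⟨ q≤1 ⟩
    1ℚ           ∎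
    where open ≤-Reasoning

  ½≤1 : ½ ≤ 1ℚ
  ½≤1 = from-yes (½ ≤? 1ℚ)

  powℚ-antitone : ∀ {q} .{{_ : NonNegative q}} → q ≤ 1ℚ →
                  ∀ {a b} → a ℕ.≤ b → powℚ q b ≤ powℚ q a
  powℚ-antitone     q≤1 {b = b} ℕ.z≤n = powℚ≤1 q≤1 b
  powℚ-antitone {q} q≤1 (ℕ.s≤s a≤b)   = *-monoˡ-≤-nonNeg q (powℚ-antitone q≤1 a≤b)

  cliqueFamily : (m : ℕ) → Family (GV m)
  cliqueFamily zero    = (1ℚ , λ _ → true) ∷ []
  cliqueFamily (suc m) = rescale ½ (extend true)  (cliqueFamily m)
                      ++ rescale ½ (extend false) (cliqueFamily m)

  cliqueFamily-nonNeg : ∀ m → NonNegativeWeights (cliqueFamily m)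
  cliqueFamily-nonNeg zero    = nonNegative⁻¹ 1ℚ ∷ []
  cliqueFamily-nonNeg (suc m) = ++⁺ (rescale-nonNeg ½ (extend true)  (cliqueFamily-nonNeg m))
                                    (rescale-nonNeg ½ (extend false) (cliqueFamily-nonNeg m))

  cliqueFamily-cliques : ∀ m → All (IsClique (Adj m) ∘ proj₂) (cliqueFamily m)
  cliqueFamily-cliques zero    = (λ _ _ _ _ tt≢tt → tt≢tt refl) ∷ []
  cliqueFamily-cliques (suc m) = ++⁺ (lift true) (lift false)
    where
    lift : ∀ b → All (IsClique (Adj (suc m)) ∘ proj₂) (rescale ½ (extend b) (cliqueFamily m))
    lift b = map⁺ (All.map (extend-clique b) (cliqueFamily-cliques m))

  weightWhere-cliqueFamily-suc :
    ∀ m P → weightWhere (cliqueFamily (suc m)) P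
          ≡ ½ * weightWhere (cliqueFamily m) (P ∘ extend true)
          + ½ * weightWhere (cliqueFamily m) (P ∘ extend false)
  weightWhere-cliqueFamily-suc m P =
    trans (weightWhere-++ (rescale ½ (extend true) (cliqueFamily m)) _ P)
          (cong₂ _+_ (weightWhere-rescale ½ (extend true)  (cliqueFamily m) P)
                     (weightWhere-rescale ½ (extend false) (cliqueFamily m) P))

  cliqueFamily-total : ∀ m → weightWhere (cliqueFamily m) (λ _ → true) ≡ 1ℚ
  cliqueFamily-total zero    = refl
  cliqueFamily-total (suc m) =
    trans (weightWhere-cliqueFamily-suc m (λ _ → true))
          (cong₂ (λ x y → ½ * x + ½ * y) (cliqueFamily-total m) (cliqueFamily-total m))

  cliqueFamily-vertex : ∀ m (v : GV m) → weightWhere (cliqueFamily m) (λ S → S v) ≡ powℚ ½ (depth v)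
  cliqueFamily-vertex zero    v = refl
  cliqueFamily-vertex (suc m) v = trans (weightWhere-cliqueFamily-suc m (λ S → S v)) (bySide v)
    where
    halves : ℚ → ℚ → ℚ
    halves x y = ½ * x + ½ * y
    weightNone : weightWhere (cliqueFamily m) (λ _ → false) ≡ 0ℚ
    weightNone = weightWhere-false (cliqueFamily m)
    bySide : ∀ v → halves (weightWhere (cliqueFamily m) (λ S → extend true S v))
                          (weightWhere (cliqueFamily m) (λ S → extend false S v))
                 ≡ powℚ ½ (depth v)
    bySide (inj₁ (true  , _)) = cong₂ halves (cliqueFamily-total m) weightNone
    bySide (inj₁ (false , _)) = cong₂ halves weightNone (cliqueFamily-total m)
    bySide (inj₂ (true  , w)) =
      trans (cong₂ halves (cliqueFamily-vertex m w) weightNone) (+-identityʳ _)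
    bySide (inj₂ (false , w)) =
      trans (cong₂ halves weightNone (cliqueFamily-vertex m w)) (+-identityˡ _)

  cliqueCover : ∀ m {_<_ : GV m → GV m → Set} →
                (∀ v w → Comparable _<_ v w → v ≢ w × ¬ Adj m v w) → ConvexComb _<_
  cliqueCover m incomparable = record
    { terms  = cliqueFamily m
    ; nonneg = All.lookup (cliqueFamily-nonNeg m)
    ; stable = clique⇒stable incomparable ∘ All.lookup (cliqueFamily-cliques m)
    ; sumOne = trans (sym (weightWhere-true (cliqueFamily m))) (cliqueFamily-total m)
    }

open CliqueCover

open import Data.Nat using (_+_; _*_; _^_; _≤_)
open import Data.Nat.Properties using (m≤m+n; +-commutativeSemigroup; module ≤-Reasoning)
open import Data.Nat.ListAction.Properties using (sum-++)
open import Data.Nat.Tactic.RingSolver using (solve-∀)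
open import Algebra.Properties.CommutativeSemigroup +-commutativeSemigroup using (interchange)

sum-map-++ : ∀ {A B C : Set} (f : C → ℕ) (g : A → C) (h : B → C) xs ys →
             sum (map f (map g xs ++ map h ys)) ≡ sum (map (f ∘ g) xs) + sum (map (f ∘ h) ys)
sum-map-++ f g h xs ys = begin
  sum (map f (map g xs ++ map h ys))            ≡⟨ cong sum (map-++ f (map g xs) (map h ys)) ⟩
  sum (map f (map g xs) ++ map f (map h ys))    ≡⟨ sum-++ (map f (map g xs)) _ ⟩
  sum (map f (map g xs)) + sum (map f (map h ys)) ≡⟨ sym (cong₂ _+_ (cong sum (map-∘ xs)) (cong sum (map-∘ ys))) ⟩
  sum (map (f ∘ g) xs) + sum (map (f ∘ h) ys)   ∎
  where open ≡-Reasoning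

sum-map-+ : (f g : V → ℕ) (xs : List V) →
            sum (map (λ x → f x + g x) xs) ≡ sum (map f xs) + sum (map g xs)
sum-map-+ f g []       = refl
sum-map-+ f g (x ∷ xs) =
  trans (cong (f x + g x +_) (sum-map-+ f g xs)) (interchange (f x) (g x) _ _)

sum-map-const-1 : (xs : List V) → sum (map (λ _ → 1) xs) ≡ length xs
sum-map-const-1 []       = refl
sum-map-const-1 (x ∷ xs) = cong suc (sum-map-const-1 xs)

vertexSum : (m : ℕ) → (GV m → ℕ) → ℕ
vertexSum m f = sum (map f (allGV m))

vertexSum-suc : ∀ m (f : GV (suc m) → ℕ) →
  vertexSum (suc m) f
    ≡ (sum (map (λ i → f (inj₁ (true , i))) (allFin (2 ^ m)))
       + sum (map (λ i → f (inj₁ (false , i))) (allFin (2 ^ m))))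
    + (vertexSum m (λ v → f (inj₂ (true , v))) + vertexSum m (λ v → f (inj₂ (false , v))))
vertexSum-suc m f =
  trans (sum-map-++ f inj₁ inj₂ (half (allFin (2 ^ m))) (half (allGV m)))
        (cong₂ _+_ (sum-map-++ (f ∘ inj₁) (true ,_) (false ,_) (allFin (2 ^ m)) (allFin (2 ^ m)))
                   (sum-map-++ (f ∘ inj₂) (true ,_) (false ,_) (allGV m) (allGV m)))
  where
  half : ∀ {A : Set} → List A → List (Bool × A)
  half xs = map (true ,_) xs ++ map (false ,_) xs

sum-allFin-1 : ∀ n → sum (map (λ _ → 1) (allFin n)) ≡ n
sum-allFin-1 n = trans (sum-map-const-1 (allFin n)) (length-tabulate id)

vertexCount : ∀ m → vertexSum m (λ _ → 1) ≡ suc m * 2 ^ m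
vertexCount zero    = refl
vertexCount (suc m) = begin
  vertexSum (suc m) (λ _ → 1)
    ≡⟨ vertexSum-suc m (λ _ → 1) ⟩
  _ ≡⟨ cong₂ (λ x y → (x + x) + (y + y)) (sum-allFin-1 (2 ^ m)) (vertexCount m) ⟩
  (2 ^ m + 2 ^ m) + (suc m * 2 ^ m + suc m * 2 ^ m)
    ≡⟨ regroup m (2 ^ m) ⟩
  suc (suc m) * 2 ^ suc m ∎
  where
  open ≡-Reasoning
  regroup : ∀ m p → (p + p) + (suc m * p + suc m * p) ≡ suc (suc m) * (2 * p)
  regroup = solve-∀

length-allGV : ∀ m → length (allGV m) ≡ suc m * 2 ^ m
length-allGV m = trans (sym (sum-map-const-1 (allGV m))) (vertexCount m)

depthSum : ∀ m → 2 * vertexSum m depth + 2 * 2 ^ m ≡ suc m * (2 + m) * 2 ^ m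
depthSum zero    = refl
depthSum (suc m) = begin
  2 * vertexSum (suc m) depth + 2 * 2 ^ suc m
    ≡⟨ cong (λ D → 2 * D + 2 * (2 * p)) (vertexSum-suc m depth) ⟩
  _ ≡⟨ cong₂ (λ x y → 2 * ((x + x) + (y + y)) + 2 * (2 * p)) (sum-allFin-1 p) copies ⟩
  2 * ((p + p) + ((suc m * p + D) + (suc m * p + D))) + 2 * (2 * p)
    ≡⟨ regroup m p D ⟩
  2 * (2 * D + 2 * p) + 4 * (2 + m) * p
    ≡⟨ cong (λ x → 2 * x + 4 * (2 + m) * p) (depthSum m) ⟩
  2 * (suc m * (2 + m) * p) + 4 * (2 + m) * p
    ≡⟨ factor m p ⟩
  suc (suc m) * (3 + m) * 2 ^ suc m ∎
  where
  open ≡-Reasoning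
  regroup : ∀ m p D → 2 * ((p + p) + ((suc m * p + D) + (suc m * p + D))) + 2 * (2 * p)
                    ≡ 2 * (2 * D + 2 * p) + 4 * (2 + m) * p
  regroup = solve-∀
  factor : ∀ m p → 2 * (suc m * (2 + m) * p) + 4 * (2 + m) * p ≡ suc (suc m) * (3 + m) * (2 * p)
  factor = solve-∀
  p : ℕ
  p = 2 ^ m
  D : ℕ
  D = vertexSum m depth
  copies : vertexSum m (suc ∘ depth) ≡ suc m * p + D
  copies = trans (sum-map-+ (λ _ → 1) depth (allGV m)) (cong (_+ D) (vertexCount m))

twice-depthSum≤ : ∀ m → 2 * vertexSum m depth ≤ length (allGV m) * (suc m + 1)
twice-depthSum≤ m = begin
  2 * vertexSum m depth                    ≤⟨ m≤m+n _ _ ⟩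
  2 * vertexSum m depth + 2 * 2 ^ m        ≡⟨ depthSum m ⟩
  suc m * (2 + m) * 2 ^ m                  ≡⟨ reshape m (2 ^ m) ⟩
  suc m * 2 ^ m * (suc m + 1)              ≡⟨ cong (_* (suc m + 1)) (sym (length-allGV m)) ⟩
  length (allGV m) * (suc m + 1)           ∎
  where
  open ≤-Reasoning
  reshape : ∀ m p → suc m * (2 + m) * p ≡ suc m * p * (suc m + 1)
  reshape = solve-∀

lemma4 : (m : ℕ) (_<_ : GV m → GV m → Set) →
         IsIntervalOrder _<_ →
         (∀ v w → Comparable _<_ v w ⇔ ((v ≢ w) × ¬ Adj m v w)) →
         HAtMost _<_ (allGV m) (suc m + 1) 2
lemma4 m _<_ _ comparable⇔ = cover , entropyBound
  where
  cover : ConvexComb _<_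
  cover = cliqueCover m (λ v w → Equivalence.to (comparable⇔ v w))
  entropyBound : powℚ ℚ.½ (length (allGV m) * (suc m + 1))
                 ℚ.≤ powℚ (prodℚ (allGV m) (ConvexComb.point cover)) 2
  entropyBound = begin
    powℚ ℚ.½ (length (allGV m) * (suc m + 1))
      ≤⟨ powℚ-antitone ½≤1 (twice-depthSum≤ m) ⟩
    powℚ ℚ.½ (2 * vertexSum m depth)
      ≡⟨ sym (powℚ-powℚ ℚ.½ (vertexSum m depth) 2) ⟩
    powℚ (powℚ ℚ.½ (vertexSum m depth)) 2
      ≡⟨ cong (λ x → powℚ x 2) (sym (prodℚ-powℚ ℚ.½ (allGV m) depth (cliqueFamily-vertex m))) ⟩
    powℚ (prodℚ (allGV m) (ConvexComb.point cover)) 2 ∎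
    where open ℚP.≤-Reasoning
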